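{- Let $G$ be a finite abelian group of order $n\ge 2$, and let $l$ be the order of its subgroup of elements of order at most $2$. Then $C_2(G)=(n+l)/2$.
   Context: $G$ is written additively. For $A\subseteq G$ and a positive integer $h$, $h\hat{\;}A$ denotes the set of all sums of $h$ pairwise distinct elements of $A$. $C_h(G)=\max\{|A| : A\subseteq G,\ h\hat{\;}A\neq G\}$. -}

module Defs where

open import Level using (Level)
open import Data.Nat using (ℕ; _≤_)
open import Data.Fin using (Fin)
open import Data.Fin.Subset using (Subset; _∈_; ∣_∣)
open import Data.Product using (Σ; _×_; ∃; ∃-syntax)
open import Relation.Nullary using (¬_)
open import Relation.Binary.PropositionalEquality using (_≡_; _≢_)
open import Algebra.Bundles using (AbelianGroup)

-- A finite abelian group G of order n is given by an AbelianGroup G together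
-- with an enumeration  e : Fin n → Carrier G  which is a bijection (w.r.t. the
-- group's setoid equality).  Subsets of G are then represented by subsets of
-- Fin n (A ⊆ Fin n stands for { e i | i ∈ A }), and |A| = ∣ A ∣.

module _ {c ℓ : Level} (G : AbelianGroup c ℓ) {n : ℕ} (e : Fin n → AbelianGroup.Carrier G) where
  open AbelianGroup G

  In2hat : Subset n → Carrier → Set ℓ
  In2hat A g = ∃[ i ] ∃[ j ] (i ∈ A × j ∈ A × i ≢ j × (e i ∙ e j ≈ g))

  Not2hatCovers : Subset n → Set (c Level.⊔ ℓ)
  Not2hatCovers A = ¬ (∀ g → In2hat A g)

  IsC2 : ℕ → Set (c Level.⊔ ℓ)
  IsC2 k = (Σ (Subset n) λ A → Not2hatCovers A × ∣ A ∣ ≡ k)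
         × (∀ (A : Subset n) → Not2hatCovers A → ∣ A ∣ ≤ k)

{-# OPTIONS --safe #-}
-- For g ∈ G the map x ↦ g − x is an involution of G whose fixed points are the solutions
-- of x + x = g; any two of them differ by an element of order at most 2, so there are at
-- most l. If g ∉ 2^A then A contains no 2-cycle {x, g − x}, hence 2|A| ≤ n + l, and a set
-- with 2|A| > n + l has 2^A = G. Conversely, for g = 0 the fixed points are exactly the l
-- elements of order at most 2; together with one element of each pair {x, −x} they form a
-- set of size (n + l)/2 whose two-element sums never vanish.
module Submission where

open import Defs
open import Level using (Level)
open import Data.Nat using (ℕ; _≤_; _+_; _/_)
open import Data.Fin using (Fin)
open import Data.Fin.Subset using (Subset; _∈_; ∣_∣)
open import Relation.Binary.PropositionalEquality using (_≡_; setoid)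
open import Function.Bundles using (Bijection; _⇔_)
open import Algebra.Bundles using (AbelianGroup)

open import Data.Nat using (zero; suc; _*_; _<_; z≤n; s≤s)
open import Data.Nat.Properties
  using (≤-refl; ≤-antisym; ≤-reflexive; ≤-trans; ≤-<-trans; +-mono-≤; +-monoʳ-≤; +-identityʳ;
         *-comm; ≮⇒≥; ≤⇒≯; module ≤-Reasoning; +-commutativeSemigroup; +-0-commutativeMonoid)
open import Data.Nat.DivMod using (m*n/n≡m; /-monoˡ-≤)
open import Data.Bool using (if_then_else_)
open import Data.Fin using (zero; suc) renaming (_≤_ to _≤ᶠ_)
open import Data.Fin.Properties using (_≟_; _≤?_; any?)
  renaming (≤-antisym to ≤ᶠ-antisym; ≤-total to ≤ᶠ-total; ≤-reflexive to ≤ᶠ-reflexive)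
open import Data.Fin.Subset using (inside; outside)
open import Data.Fin.Subset.Properties using (_∈?_)
open import Data.Fin.Permutation using (Permutation; permutation; _⟨$⟩ʳ_)
open import Data.Vec using (_∷_; []; tabulate)
open import Data.Vec.Properties using ([]=⇒lookup; lookup∘tabulate)
open import Data.Product using (_×_; _,_; ∃-syntax)
open import Data.Sum using ([_,_]′)
open import Data.Empty using (⊥-elim)
open import Function using (_∘_)
open import Function.Bundles using (Surjection; mk⇔; Equivalence)
open import Function.Definitions using (Congruent)
import Relation.Binary.Reasoning.Setoid as SetoidReasoning
open import Relation.Nullary using (Dec; yes; no; does; ¬_; ¬?; contradiction)
open import Relation.Nullary.Decidable using (_×-dec_)
open import Relation.Unary using (Pred; Decidable; _⊆_; _≐_)
import Relation.Binary.PropositionalEquality as ≡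
open ≡ using (refl; cong; cong₂; subst; _≢_; module ≡-Reasoning)
open import Algebra.Properties.CommutativeMonoid.Sum +-0-commutativeMonoid
  using (sum; sum-cong-≗; ∑-distrib-+; sum-permute)
open import Algebra.Properties.CommutativeSemigroup +-commutativeSemigroup using (x∙yz≈y∙xz)

indicator : ∀ {p} {P : Set p} → Dec P → ℕ
indicator P? = if does P? then 1 else 0

count : ∀ {n p} {P : Pred (Fin n) p} → Decidable P → ℕ
count P? = sum (indicator ∘ P?)

sum-mono : ∀ {n} {f g : Fin n → ℕ} → (∀ i → f i ≤ g i) → sum f ≤ sum g
sum-mono {zero}  f≤g = z≤n
sum-mono {suc n} f≤g = +-mono-≤ (f≤g zero) (sum-mono (f≤g ∘ suc))

count-mono : ∀ {p q n} {P : Pred (Fin n) p} {Q : Pred (Fin n) q} (P? : Decidable P) (Q? : Decidable Q) →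
             P ⊆ Q → count P? ≤ count Q?
count-mono P? Q? P⊆Q = sum-mono indicator-mono
  where
  indicator-mono : ∀ i → indicator (P? i) ≤ indicator (Q? i)
  indicator-mono i with P? i | Q? i
  ... | yes _  | yes _  = ≤-refl
  ... | yes Pi | no ¬Qi = contradiction (P⊆Q Pi) ¬Qi
  ... | no _   | _      = z≤n

count-cong : ∀ {p q n} {P : Pred (Fin n) p} {Q : Pred (Fin n) q} (P? : Decidable P) (Q? : Decidable Q) →
             P ≐ Q → count P? ≡ count Q?
count-cong P? Q? (P⊆Q , Q⊆P) = ≤-antisym (count-mono P? Q? P⊆Q) (count-mono Q? P? Q⊆P)

count-permute : ∀ {p n} {P : Pred (Fin n) p} (P? : Decidable P) (π : Permutation n n) →
                count P? ≡ count (P? ∘ (π ⟨$⟩ʳ_))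
count-permute P? π = sum-permute (indicator ∘ P?) π

n+count≡∑suc : ∀ {p n} {P : Pred (Fin n) p} (P? : Decidable P) → n + count P? ≡ sum (suc ∘ indicator ∘ P?)
n+count≡∑suc {n = zero}  P? = refl
n+count≡∑suc {n = suc n} P? =
  cong suc (≡.trans (x∙yz≈y∙xz n (indicator (P? zero)) _)
                    (cong (indicator (P? zero) +_) (n+count≡∑suc (P? ∘ suc))))

∣p∣≡count-∈ : ∀ {n} (p : Subset n) → ∣ p ∣ ≡ count (_∈? p)
∣p∣≡count-∈ []            = refl
∣p∣≡count-∈ (inside ∷ p)  = cong suc (∣p∣≡count-∈ p)
∣p∣≡count-∈ (outside ∷ p) = ∣p∣≡count-∈ p

toSubset : ∀ {p n} {P : Pred (Fin n) p} → Decidable P → Subset n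
toSubset P? = tabulate (does ∘ P?)

∣toSubset∣≡count : ∀ {p n} {P : Pred (Fin n) p} (P? : Decidable P) → ∣ toSubset P? ∣ ≡ count P?
∣toSubset∣≡count {n = zero}  P? = refl
∣toSubset∣≡count {n = suc n} P? with P? zero
... | yes _ = cong suc (∣toSubset∣≡count (P? ∘ suc))
... | no _  = ∣toSubset∣≡count (P? ∘ suc)

∈-toSubset⁻ : ∀ {p n} {P : Pred (Fin n) p} (P? : Decidable P) {i} → i ∈ toSubset P? → P i
∈-toSubset⁻ P? {i} i∈ with P? i | ≡.trans (≡.sym (lookup∘tabulate (does ∘ P?) i)) ([]=⇒lookup i∈)
... | yes Pi | _ = Pi
... | no _   | ()

indicator-≤+≥≡1+≡ : ∀ {n} {i j : Fin n} (i≤j? : Dec (i ≤ᶠ j)) (j≤i? : Dec (j ≤ᶠ i)) (j≟i : Dec (j ≡ i)) →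
                    indicator i≤j? + indicator j≤i? ≡ suc (indicator j≟i)
indicator-≤+≥≡1+≡ (yes _)   (yes _)   (yes _)   = refl
indicator-≤+≥≡1+≡ (yes i≤j) (yes j≤i) (no j≢i)  = contradiction (≤ᶠ-antisym j≤i i≤j) j≢i
indicator-≤+≥≡1+≡ (yes _)   (no j≰i)  (yes j≡i) = contradiction (≤ᶠ-reflexive j≡i) j≰i
indicator-≤+≥≡1+≡ (yes _)   (no _)    (no _)    = refl
indicator-≤+≥≡1+≡ (no i≰j)  (yes _)   (yes j≡i) = contradiction (≤ᶠ-reflexive (≡.sym j≡i)) i≰j
indicator-≤+≥≡1+≡ (no _)    (yes _)   (no _)    = refl
indicator-≤+≥≡1+≡ {i = i} {j} (no i≰j) (no j≰i) _ = ⊥-elim ([ i≰j , j≰i ]′ (≤ᶠ-total i j))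

module Involution {n} (σ : Fin n → Fin n) (σ-involutive : ∀ i → σ (σ i) ≡ i) where

  fixed? : Decidable (λ i → σ i ≡ i)
  fixed? i = σ i ≟ i

  count-twice : ∀ {p} {P : Pred (Fin n) p} (P? : Decidable P) →
                count P? + count P? ≡ sum (λ i → indicator (P? i) + indicator (P? (σ i)))
  count-twice P? = begin
    count P? + count P?        ≡⟨ cong (count P? +_) (count-permute P? (permutation σ σ σ-involutive σ-involutive)) ⟩
    count P? + count (P? ∘ σ)  ≡⟨ ≡.sym (∑-distrib-+ (indicator ∘ P?) (indicator ∘ P? ∘ σ)) ⟩
    sum (λ i → indicator (P? i) + indicator (P? (σ i))) ∎
    where open ≡-Reasoning

  pigeonhole : (A : Subset n) → n + count fixed? < ∣ A ∣ + ∣ A ∣ → ∃[ i ] (i ∈ A × σ i ∈ A × i ≢ σ i)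
  pigeonhole A large with any? (λ i → i ∈? A ×-dec σ i ∈? A ×-dec ¬? (i ≟ σ i))
  ... | yes orbit = orbit
  ... | no none   = contradiction large (≤⇒≯ bound)
    where
    pair-bound : ∀ i → indicator (i ∈? A) + indicator (σ i ∈? A) ≤ suc (indicator (fixed? i))
    pair-bound i with i ∈? A | σ i ∈? A | fixed? i
    ... | yes _   | yes _    | yes _   = ≤-refl
    ... | yes i∈A | yes σi∈A | no σi≢i = contradiction (i , i∈A , σi∈A , σi≢i ∘ ≡.sym) none
    ... | yes _   | no _     | _       = s≤s z≤n
    ... | no _    | yes _    | _       = s≤s z≤n
    ... | no _    | no _     | _       = z≤n

    open ≤-Reasoning
    bound : ∣ A ∣ + ∣ A ∣ ≤ n + count fixed?
    bound = begin
      ∣ A ∣ + ∣ A ∣                  ≡⟨ cong₂ _+_ (∣p∣≡count-∈ A) (∣p∣≡count-∈ A) ⟩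
      count (_∈? A) + count (_∈? A)  ≡⟨ count-twice (_∈? A) ⟩
      sum (λ i → indicator (i ∈? A) + indicator (σ i ∈? A)) ≤⟨ sum-mono pair-bound ⟩
      sum (suc ∘ indicator ∘ fixed?) ≡⟨ n+count≡∑suc fixed? ⟨
      n + count fixed?               ∎

  below? : Decidable (λ i → i ≤ᶠ σ i)
  below? i = i ≤? σ i

  lowerHalf : Subset n
  lowerHalf = toSubset below?

  lowerHalf-orbit : ∀ {i} → i ∈ lowerHalf → σ i ∈ lowerHalf → σ i ≡ i
  lowerHalf-orbit {i} i∈ σi∈ =
    ≤ᶠ-antisym (subst (σ i ≤ᶠ_) (σ-involutive i) (∈-toSubset⁻ below? σi∈)) (∈-toSubset⁻ below? i∈)

  ∣lowerHalf∣+∣lowerHalf∣ : ∣ lowerHalf ∣ + ∣ lowerHalf ∣ ≡ n + count fixed?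
  ∣lowerHalf∣+∣lowerHalf∣ = begin
    ∣ lowerHalf ∣ + ∣ lowerHalf ∣  ≡⟨ cong₂ _+_ (∣toSubset∣≡count below?) (∣toSubset∣≡count below?) ⟩
    count below? + count below?    ≡⟨ count-twice below? ⟩
    sum (λ i → indicator (i ≤? σ i) + indicator (σ i ≤? σ (σ i))) ≡⟨ sum-cong-≗ pair-count ⟩
    sum (suc ∘ indicator ∘ fixed?) ≡⟨ n+count≡∑suc fixed? ⟨
    n + count fixed?               ∎
    where
    open ≡-Reasoning
    pair-count : ∀ i → indicator (i ≤? σ i) + indicator (σ i ≤? σ (σ i)) ≡ suc (indicator (fixed? i))
    pair-count i = ≡.trans (cong (λ j → indicator (i ≤? σ i) + indicator (σ i ≤? j)) (σ-involutive i))
                           (indicator-≤+≥≡1+≡ (i ≤? σ i) (σ i ≤? i) (fixed? i))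

module _ {c ℓ} (G : AbelianGroup c ℓ) where
  open AbelianGroup G
  open import Algebra.Properties.Group group using (x≈z//y; //-rightDividesˡ; x≈y⇒x∙y⁻¹≈ε)
  open import Algebra.Properties.AbelianGroup G using (⁻¹-∙-comm)
  open import Algebra.Properties.CommutativeSemigroup commutativeSemigroup using (interchange)

  x∙y≈z⇒y≈z-x : ∀ x y z → x ∙ y ≈ z → y ≈ z - x
  x∙y≈z⇒y≈z-x x y z x∙y≈z = x≈z//y y x z (trans (comm y x) x∙y≈z)

  x∙[y-x]≈y : ∀ x y → x ∙ (y - x) ≈ y
  x∙[y-x]≈y x y = trans (comm x (y - x)) (//-rightDividesˡ x y)

  x-[x-y]≈y : ∀ x y → x - (x - y) ≈ y
  x-[x-y]≈y x y = sym (x∙y≈z⇒y≈z-x (x - y) y x (//-rightDividesˡ y x))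

  [x-y]∙[x-y]≈x∙x-y∙y : ∀ x y → (x - y) ∙ (x - y) ≈ (x ∙ x) - (y ∙ y)
  [x-y]∙[x-y]≈x∙x-y∙y x y = trans (interchange x (y ⁻¹) x (y ⁻¹)) (∙-congˡ (⁻¹-∙-comm y y))

  x∙x≈y∙y⇒[x-y]∙[x-y]≈ε : ∀ {x y} → x ∙ x ≈ y ∙ y → (x - y) ∙ (x - y) ≈ ε
  x∙x≈y∙y⇒[x-y]∙[x-y]≈ε {x} {y} eq = trans ([x-y]∙[x-y]≈x∙x-y∙y x y) (x≈y⇒x∙y⁻¹≈ε eq)

module Enumerated {c ℓ} (G : AbelianGroup c ℓ) {n : ℕ}
                  (enum : Bijection (setoid (Fin n)) (AbelianGroup.setoid G)) where
  open AbelianGroup G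
  open Bijection enum using (to; to⁻; injective)
  open import Algebra.Properties.Group group using (//-rightDividesˡ; //-rightDividesʳ)

  to∘to⁻ : ∀ x → to (to⁻ x) ≈ x
  to∘to⁻ = Surjection.to∘to⁻ (Bijection.surjection enum)

  induced : (Carrier → Carrier) → Fin n → Fin n
  induced f i = to⁻ (f (to i))

  induced-inverse : ∀ {f h} → Congruent _≈_ _≈_ f → (∀ x → f (h x) ≈ x) → ∀ i → induced f (induced h i) ≡ i
  induced-inverse {f} {h} f-cong f∘h≈id i = injective (begin
    to (induced f (induced h i)) ≈⟨ to∘to⁻ _ ⟩
    f (to (induced h i))         ≈⟨ f-cong (to∘to⁻ _) ⟩
    f (h (to i))                 ≈⟨ f∘h≈id (to i) ⟩
    to i                         ∎)
    where open SetoidReasoning (AbelianGroup.setoid G)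

  translation : Carrier → Permutation n n
  translation y = permutation (induced (_∙ y)) (induced (_- y))
    (induced-inverse ∙-congʳ (//-rightDividesˡ y)) (induced-inverse ∙-congʳ (//-rightDividesʳ y))

  reflect : Carrier → Fin n → Fin n
  reflect g = induced (g -_)

  reflect-involutive : ∀ g i → reflect g (reflect g i) ≡ i
  reflect-involutive g = induced-inverse (∙-congˡ ∘ ⁻¹-cong) (x-[x-y]≈y G g)

  module Reflection (g : Carrier) = Involution (reflect g) (reflect-involutive g)

  to∙to-reflect : ∀ g i → to i ∙ to (reflect g i) ≈ g
  to∙to-reflect g i = trans (∙-congˡ (to∘to⁻ _)) (x∙[y-x]≈y G (to i) g)

  reflect-unique : ∀ {g i j} → to i ∙ to j ≈ g → j ≡ reflect g i
  reflect-unique i∙j≈g = injective (trans (x∙y≈z⇒y≈z-x G _ _ _ i∙j≈g) (sym (to∘to⁻ _)))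

  reflect-fixed⇔ : ∀ {g i} → reflect g i ≡ i ⇔ to i ∙ to i ≈ g
  reflect-fixed⇔ {g} {i} = mk⇔ (λ fixed → subst (λ j → to i ∙ to j ≈ g) fixed (to∙to-reflect g i))
                               (λ square → ≡.sym (reflect-unique square))

  module OrderAtMostTwo (T : Subset n) (T-spec : ∀ i → i ∈ T ⇔ to i ∙ to i ≈ ε) where

    -- Any two solutions of x ∙ x ≈ g differ by an element of T, so translating by one
    -- solution h maps all of them into T.
    count-fixed≤∣T∣ : ∀ g → count (Reflection.fixed? g) ≤ ∣ T ∣
    count-fixed≤∣T∣ g with any? (Reflection.fixed? g)
    ... | no no-fixed = ≤-trans
      (count-mono (Reflection.fixed? g) (_∈? T) (λ {i} fixed → contradiction (i , fixed) no-fixed))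
      (≤-reflexive (≡.sym (∣p∣≡count-∈ T)))
    ... | yes (h , h-fixed) = begin
      count (Reflection.fixed? g)  ≤⟨ count-mono (Reflection.fixed? g) ((_∈? T) ∘ (τ ⟨$⟩ʳ_)) fixed⇒τ∈T ⟩
      count ((_∈? T) ∘ (τ ⟨$⟩ʳ_))  ≡⟨ count-permute (_∈? T) τ ⟨
      count (_∈? T)                ≡⟨ ∣p∣≡count-∈ T ⟨
      ∣ T ∣                        ∎
      where
      open ≤-Reasoning
      τ : Permutation n n
      τ = translation (to h ⁻¹)
      fixed⇒τ∈T : ∀ {i} → reflect g i ≡ i → τ ⟨$⟩ʳ i ∈ T
      fixed⇒τ∈T {i} fixed = Equivalence.from (T-spec (τ ⟨$⟩ʳ i))
        (trans (∙-cong (to∘to⁻ _) (to∘to⁻ _))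
               (x∙x≈y∙y⇒[x-y]∙[x-y]≈ε G (trans (Equivalence.to reflect-fixed⇔ fixed)
                                               (sym (Equivalence.to reflect-fixed⇔ h-fixed)))))

    count-fixed-ε≡∣T∣ : count (Reflection.fixed? ε) ≡ ∣ T ∣
    count-fixed-ε≡∣T∣ =
      ≡.trans (count-cong (Reflection.fixed? ε) (_∈? T) (fixed⇒∈T , ∈T⇒fixed)) (≡.sym (∣p∣≡count-∈ T))
      where
      fixed⇒∈T : ∀ {i} → reflect ε i ≡ i → i ∈ T
      fixed⇒∈T {i} = Equivalence.from (T-spec i) ∘ Equivalence.to reflect-fixed⇔
      ∈T⇒fixed : ∀ {i} → i ∈ T → reflect ε i ≡ i
      ∈T⇒fixed {i} = Equivalence.from reflect-fixed⇔ ∘ Equivalence.to (T-spec i)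

    large⇒covers : (A : Subset n) → n + ∣ T ∣ < ∣ A ∣ + ∣ A ∣ → ∀ g → In2hat G to A g
    large⇒covers A large g
      with Reflection.pigeonhole g A (≤-<-trans (+-monoʳ-≤ n (count-fixed≤∣T∣ g)) large)
    ... | i , i∈A , j∈A , i≢j = i , reflect g i , i∈A , j∈A , i≢j , to∙to-reflect g i

    negationHalf : Subset n
    negationHalf = Reflection.lowerHalf ε

    ε∉2^negationHalf : ¬ In2hat G to negationHalf ε
    ε∉2^negationHalf (i , j , i∈ , j∈ , i≢j , i∙j≈ε) with reflect-unique i∙j≈ε
    ... | refl = i≢j (≡.sym (Reflection.lowerHalf-orbit ε i∈ j∈))

    ∣negationHalf∣+∣negationHalf∣ : ∣ negationHalf ∣ + ∣ negationHalf ∣ ≡ n + ∣ T ∣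
    ∣negationHalf∣+∣negationHalf∣ =
      ≡.trans (Reflection.∣lowerHalf∣+∣lowerHalf∣ ε) (cong (n +_) count-fixed-ε≡∣T∣)

[m+m]/2≡m : ∀ m → (m + m) / 2 ≡ m
[m+m]/2≡m m = ≡.trans (cong (_/ 2) (≡.sym m*2≡m+m)) (m*n/n≡m m 2)
  where
  m*2≡m+m : m * 2 ≡ m + m
  m*2≡m+m = ≡.trans (*-comm m 2) (cong (m +_) (+-identityʳ m))

m+m≤n⇒m≤n/2 : ∀ {m n} → m + m ≤ n → m ≤ n / 2
m+m≤n⇒m≤n/2 {m} m+m≤n = subst (_≤ _) ([m+m]/2≡m m) (/-monoˡ-≤ 2 m+m≤n)

m+m≡n⇒m≡n/2 : ∀ {m n} → m + m ≡ n → m ≡ n / 2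
m+m≡n⇒m≡n/2 {m} m+m≡n = ≡.trans (≡.sym ([m+m]/2≡m m)) (cong (_/ 2) m+m≡n)

theorem2p4 : {c ℓ : Level} (G : AbelianGroup c ℓ) (n : ℕ) → 2 ≤ n →
    (enum : Bijection (setoid (Fin n)) (AbelianGroup.setoid G)) →
    (T : Subset n) →
    (∀ i → (i ∈ T) ⇔ (AbelianGroup._≈_ G (AbelianGroup._∙_ G (Bijection.to enum i) (Bijection.to enum i)) (AbelianGroup.ε G))) →
    IsC2 G (Bijection.to enum) ((n + ∣ T ∣) / 2)
theorem2p4 G n _ enum T T-spec =
  (negationHalf , (λ covers → ε∉2^negationHalf (covers _)) , m+m≡n⇒m≡n/2 ∣negationHalf∣+∣negationHalf∣) ,
  (λ A A-misses → m+m≤n⇒m≤n/2 (≮⇒≥ (A-misses ∘ large⇒covers A)))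
  where open Enumerated.OrderAtMostTwo G enum T T-spec
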